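{- Let $d\geq 1$ and let $D$ be an oriented graph of minimum semi-degree $d$ with strong connectivity $k$, and put $k'=k/d$. Let $K$ be a set of $k$ vertices disconnecting $D$, and let $(A,B)$ be a partition of $V(D)\setminus K$ into nonempty sets such that there is no arc from a vertex of $B$ to a vertex of $A$. If $D$ contains no directed triangle, then for every arc $(y,x)$ of $D$ with $y\in A$ and $x\in B$ it holds that $$d_B^+(x)+d_A^-(y)\geq 2d-k'd.$$
   Context: Digraphs have no loops and no parallel arcs. An oriented graph is a digraph in which for any two distinct vertices $x,y$ at most one of $(x,y),(y,x)$ is an arc. The minimum semi-degree of $D$ is the minimum of its minimum out-degree and its minimum in-degree. A set $S$ of vertices disconnects $D$ if $D-S$ is not strongly connected; the strong connectivity of $D$ is the smallest cardinality of a vertex set disconnecting $D$. For a vertex $v$ and a set $S$ of vertices, $d_S^+(v)$ is the number of out-neighbours of $v$ in $S$ and $d_S^-(v)$ the number of in-neighbours of $v$ in $S$. A directed triangle is a directed cycle of length $3$. -}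

module Defs where

open import Data.Nat using (ℕ; _≤_)
open import Data.Bool using (Bool; true; false; T)
open import Data.Fin using (Fin)
open import Data.Fin.Subset using (Subset; _∈_; _∉_; _∩_; ∣_∣)
open import Data.Vec using (tabulate)
open import Data.Product using (_×_; ∃; ∃-syntax)
open import Data.Sum using (_⊎_)
open import Relation.Nullary using (¬_)
open import Relation.Binary.PropositionalEquality using (_≡_)

-- A digraph on the vertex set Fin n; arc (u,v) present iff arc u v ≡ true.
-- No loops (no parallel arcs is automatic for a relation).
record Digraph (n : ℕ) : Set where
  field
    arc      : Fin n → Fin n → Bool
    loopless : ∀ v → arc v v ≡ false

open Digraph public

Arc : ∀ {n} → Digraph n → Fin n → Fin n → Set
Arc D u v = T (arc D u v)

Oriented : ∀ {n} → Digraph n → Set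
Oriented D = ∀ x y → Arc D x y → ¬ Arc D y x

outNbrs : ∀ {n} → Digraph n → Fin n → Subset n
outNbrs D v = tabulate (λ w → arc D v w)

inNbrs : ∀ {n} → Digraph n → Fin n → Subset n
inNbrs D v = tabulate (λ w → arc D w v)

outDegIn : ∀ {n} → Digraph n → Subset n → Fin n → ℕ
outDegIn D S v = ∣ S ∩ outNbrs D v ∣

inDegIn : ∀ {n} → Digraph n → Subset n → Fin n → ℕ
inDegIn D S v = ∣ S ∩ inNbrs D v ∣

outDeg : ∀ {n} → Digraph n → Fin n → ℕ
outDeg D v = ∣ outNbrs D v ∣

inDeg : ∀ {n} → Digraph n → Fin n → ℕ
inDeg D v = ∣ inNbrs D v ∣

MinSemiDegree : ∀ {n} → Digraph n → ℕ → Set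
MinSemiDegree D d =
  (∀ v → d ≤ outDeg D v × d ≤ inDeg D v) ×
  (∃[ v ] (outDeg D v ≡ d ⊎ inDeg D v ≡ d))

data Reach {n} (D : Digraph n) (S : Subset n) : Fin n → Fin n → Set where
  here : ∀ {v} → v ∉ S → Reach D S v v
  step : ∀ {u w v} → u ∉ S → Arc D u w → Reach D S w v → Reach D S u v

StronglyConnectedMinus : ∀ {n} → Digraph n → Subset n → Set
StronglyConnectedMinus D S = ∀ u v → u ∉ S → v ∉ S → Reach D S u v

Disconnects : ∀ {n} → Digraph n → Subset n → Set
Disconnects D S = ¬ StronglyConnectedMinus D S

StrongConnectivity : ∀ {n} → Digraph n → ℕ → Set
StrongConnectivity D k =
  (∃[ S ] (Disconnects D S × ∣ S ∣ ≡ k)) ×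
  (∀ S → Disconnects D S → k ≤ ∣ S ∣)

NoDirectedTriangle : ∀ {n} → Digraph n → Set
NoDirectedTriangle D = ∀ a b c → Arc D a b → Arc D b c → ¬ Arc D c a

PartitionOfComplement : ∀ {n} → Subset n → Subset n → Subset n → Set
PartitionOfComplement K A B =
  (∀ v → v ∈ K ⊎ v ∈ A ⊎ v ∈ B) ×
  (∀ v → v ∈ A → v ∉ B) × (∀ v → v ∈ A → v ∉ K) × (∀ v → v ∈ B → v ∉ K)

-- Let (y,x) be an arc from A to B.  Every out-neighbour of x lies in B ∪ K
-- (an out-neighbour in A would be an arc from B to A), and every
-- in-neighbour of y lies in A ∪ K.  No vertex w is both an out-neighbour of x
-- and an in-neighbour of y, since y → x → w → y would be a directed triangle;
-- in particular the parts of N⁺(x) and N⁻(y) inside K are disjoint.  Hence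
--   d⁺(x) + d⁻(y) ≤ d⁺_B(x) + d⁻_A(y) + |K|,
-- and with d ≤ d⁺(x), d ≤ d⁻(y), |K| = k this gives 2d - k ≤ d⁺_B(x) + d⁻_A(y)
-- (note k'd = k).
module Submission where

open import Defs
open import Data.Nat using (ℕ; suc; _≤_; _*_; _+_; z≤n; s≤s)
open import Data.Nat.Properties
  using (≤-trans; +-mono-≤; +-monoʳ-≤; +-suc; m≤n⇒m≤1+n; +-comm; +-identityʳ; +-commutativeSemigroup; module ≤-Reasoning)
open import Data.Integer using (+_; _-_; _⊖_) renaming (_≤_ to _≤ℤ_)
import Data.Integer.Properties as ℤ
open import Data.Fin using (Fin)
open import Data.Fin.Subset using (Subset; _∈_; _∉_; _⊆_; ∣_∣; _∩_; _∪_; inside; outside)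
open import Data.Fin.Subset.Properties using (p⊆q⇒∣p∣≤∣q∣; x∈p∪q⁻; x∈p∪q⁺; x∈p∩q⁺; x∈p∩q⁻)
open import Data.Bool using (Bool; T)
open import Data.Bool.Properties using (T-≡)
open import Data.Product using (∃-syntax; _,_; proj₁; proj₂)
open import Data.Sum using (inj₁; inj₂)
open import Data.Vec using ([]; _∷_; here; there; tabulate)
open import Data.Vec.Properties using ([]=⇒lookup; lookup∘tabulate)
open import Function.Bundles using (module Equivalence)
open import Relation.Nullary using (¬_; contradiction)
open import Relation.Binary.PropositionalEquality using (_≡_; sym; trans; cong; subst)
open import Algebra.Properties.CommutativeSemigroup +-commutativeSemigroup using (interchange)

∣p∪q∣≤∣p∣+∣q∣ : ∀ {n} (p q : Subset n) → ∣ p ∪ q ∣ ≤ ∣ p ∣ + ∣ q ∣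
∣p∪q∣≤∣p∣+∣q∣ []            []            = z≤n
∣p∪q∣≤∣p∣+∣q∣ (inside  ∷ p) (inside  ∷ q) =
  s≤s (subst (∣ p ∪ q ∣ ≤_) (sym (+-suc ∣ p ∣ ∣ q ∣)) (m≤n⇒m≤1+n (∣p∪q∣≤∣p∣+∣q∣ p q)))
∣p∪q∣≤∣p∣+∣q∣ (inside  ∷ p) (outside ∷ q) = s≤s (∣p∪q∣≤∣p∣+∣q∣ p q)
∣p∪q∣≤∣p∣+∣q∣ (outside ∷ p) (inside  ∷ q) =
  subst (suc ∣ p ∪ q ∣ ≤_) (sym (+-suc ∣ p ∣ ∣ q ∣)) (s≤s (∣p∪q∣≤∣p∣+∣q∣ p q))
∣p∪q∣≤∣p∣+∣q∣ (outside ∷ p) (outside ∷ q) = ∣p∪q∣≤∣p∣+∣q∣ p q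

Disjoint : ∀ {n} → Subset n → Subset n → Set
Disjoint p q = ∀ {i} → i ∈ p → i ∉ q

disjoint-tail : ∀ {n} {s t} {p q : Subset n} → Disjoint (s ∷ p) (t ∷ q) → Disjoint p q
disjoint-tail sp#tq i∈p i∈q = sp#tq (there i∈p) (there i∈q)

disjoint⇒∣p∣+∣q∣≤∣p∪q∣ : ∀ {n} (p q : Subset n) → Disjoint p q → ∣ p ∣ + ∣ q ∣ ≤ ∣ p ∪ q ∣
disjoint⇒∣p∣+∣q∣≤∣p∪q∣ []            []            _   = z≤n
disjoint⇒∣p∣+∣q∣≤∣p∪q∣ (inside  ∷ p) (inside  ∷ q) p#q = contradiction here (p#q here)
disjoint⇒∣p∣+∣q∣≤∣p∪q∣ (inside  ∷ p) (outside ∷ q) p#q =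
  s≤s (disjoint⇒∣p∣+∣q∣≤∣p∪q∣ p q (disjoint-tail p#q))
disjoint⇒∣p∣+∣q∣≤∣p∪q∣ (outside ∷ p) (inside  ∷ q) p#q =
  subst (_≤ suc ∣ p ∪ q ∣) (sym (+-suc ∣ p ∣ ∣ q ∣))
    (s≤s (disjoint⇒∣p∣+∣q∣≤∣p∪q∣ p q (disjoint-tail p#q)))
disjoint⇒∣p∣+∣q∣≤∣p∪q∣ (outside ∷ p) (outside ∷ q) p#q =
  disjoint⇒∣p∣+∣q∣≤∣p∪q∣ p q (disjoint-tail p#q)

cover-bound : ∀ {n} (U P K : Subset n) → U ⊆ P ∪ K → ∣ U ∣ ≤ ∣ P ∩ U ∣ + ∣ K ∩ U ∣
cover-bound U P K U⊆P∪K = ≤-trans (p⊆q⇒∣p∣≤∣q∣ U⊆parts) (∣p∪q∣≤∣p∣+∣q∣ (P ∩ U) (K ∩ U))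
  where
  U⊆parts : U ⊆ (P ∩ U) ∪ (K ∩ U)
  U⊆parts i∈U with x∈p∪q⁻ P K (U⊆P∪K i∈U)
  ... | inj₁ i∈P = x∈p∪q⁺ (inj₁ (x∈p∩q⁺ (i∈P , i∈U)))
  ... | inj₂ i∈K = x∈p∪q⁺ (inj₂ (x∈p∩q⁺ (i∈K , i∈U)))

disjoint-within-bound : ∀ {n} (K U V : Subset n) → (∀ {i} → i ∈ U → i ∈ V → i ∉ K) →
  ∣ K ∩ U ∣ + ∣ K ∩ V ∣ ≤ ∣ K ∣
disjoint-within-bound K U V separated =
  ≤-trans (disjoint⇒∣p∣+∣q∣≤∣p∪q∣ (K ∩ U) (K ∩ V) parts-disjoint) (p⊆q⇒∣p∣≤∣q∣ parts⊆K)
  where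
  parts-disjoint : Disjoint (K ∩ U) (K ∩ V)
  parts-disjoint i∈K∩U i∈K∩V =
    separated (proj₂ (x∈p∩q⁻ K U i∈K∩U)) (proj₂ (x∈p∩q⁻ K V i∈K∩V)) (proj₁ (x∈p∩q⁻ K U i∈K∩U))
  parts⊆K : (K ∩ U) ∪ (K ∩ V) ⊆ K
  parts⊆K i∈parts with x∈p∪q⁻ (K ∩ U) (K ∩ V) i∈parts
  ... | inj₁ i∈K∩U = proj₁ (x∈p∩q⁻ K U i∈K∩U)
  ... | inj₂ i∈K∩V = proj₁ (x∈p∩q⁻ K V i∈K∩V)

two-covers-bound : ∀ {n} (U V P Q K : Subset n) → U ⊆ P ∪ K → V ⊆ Q ∪ K →
  (∀ {i} → i ∈ U → i ∈ V → i ∉ K) →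
  ∣ U ∣ + ∣ V ∣ ≤ ∣ P ∩ U ∣ + ∣ Q ∩ V ∣ + ∣ K ∣
two-covers-bound U V P Q K U⊆P∪K V⊆Q∪K separated = begin
  ∣ U ∣ + ∣ V ∣
    ≤⟨ +-mono-≤ (cover-bound U P K U⊆P∪K) (cover-bound V Q K V⊆Q∪K) ⟩
  (∣ P ∩ U ∣ + ∣ K ∩ U ∣) + (∣ Q ∩ V ∣ + ∣ K ∩ V ∣)
    ≡⟨ interchange (∣ P ∩ U ∣) (∣ K ∩ U ∣) (∣ Q ∩ V ∣) (∣ K ∩ V ∣) ⟩
  (∣ P ∩ U ∣ + ∣ Q ∩ V ∣) + (∣ K ∩ U ∣ + ∣ K ∩ V ∣)
    ≤⟨ +-monoʳ-≤ (∣ P ∩ U ∣ + ∣ Q ∩ V ∣) (disjoint-within-bound K U V separated) ⟩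
  ∣ P ∩ U ∣ + ∣ Q ∩ V ∣ + ∣ K ∣ ∎
  where open ≤-Reasoning

∈tabulate⇒T : ∀ {n} (f : Fin n → Bool) {i : Fin n} → i ∈ tabulate f → T (f i)
∈tabulate⇒T f {i} i∈f = Equivalence.from T-≡ (trans (sym (lookup∘tabulate f i)) ([]=⇒lookup i∈f))

out-nbr⇒arc : ∀ {n} (D : Digraph n) {v w : Fin n} → w ∈ outNbrs D v → Arc D v w
out-nbr⇒arc D {v} = ∈tabulate⇒T (arc D v)

in-nbr⇒arc : ∀ {n} (D : Digraph n) {v w : Fin n} → w ∈ inNbrs D v → Arc D w v
in-nbr⇒arc D {v} = ∈tabulate⇒T (λ w → arc D w v)

∉A⇒∈B∪K : ∀ {n} {K A B : Subset n} → PartitionOfComplement K A B →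
  ∀ {w} → w ∉ A → w ∈ B ∪ K
∉A⇒∈B∪K (cover , _) {w} w∉A with cover w
... | inj₁ w∈K          = x∈p∪q⁺ (inj₂ w∈K)
... | inj₂ (inj₁ w∈A)   = contradiction w∈A w∉A
... | inj₂ (inj₂ w∈B)   = x∈p∪q⁺ (inj₁ w∈B)

∉B⇒∈A∪K : ∀ {n} {K A B : Subset n} → PartitionOfComplement K A B →
  ∀ {w} → w ∉ B → w ∈ A ∪ K
∉B⇒∈A∪K (cover , _) {w} w∉B with cover w
... | inj₁ w∈K          = x∈p∪q⁺ (inj₂ w∈K)
... | inj₂ (inj₁ w∈A)   = x∈p∪q⁺ (inj₁ w∈A)
... | inj₂ (inj₂ w∈B)   = contradiction w∈B w∉B

outNbrs-of-B : ∀ {n} (D : Digraph n) {K A B : Subset n} → PartitionOfComplement K A B →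
  (∀ b a → b ∈ B → a ∈ A → ¬ Arc D b a) → ∀ {x} → x ∈ B → outNbrs D x ⊆ B ∪ K
outNbrs-of-B D part noBA {x} x∈B w∈N⁺x =
  ∉A⇒∈B∪K part (λ w∈A → noBA x _ x∈B w∈A (out-nbr⇒arc D w∈N⁺x))

inNbrs-of-A : ∀ {n} (D : Digraph n) {K A B : Subset n} → PartitionOfComplement K A B →
  (∀ b a → b ∈ B → a ∈ A → ¬ Arc D b a) → ∀ {y} → y ∈ A → inNbrs D y ⊆ A ∪ K
inNbrs-of-A D part noBA {y} y∈A w∈N⁻y =
  ∉B⇒∈A∪K part (λ w∈B → noBA _ y w∈B y∈A (in-nbr⇒arc D w∈N⁻y))

triangle-free-separation : ∀ {n} (D : Digraph n) → NoDirectedTriangle D →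
  ∀ {y x} → Arc D y x → ∀ {w} → w ∈ outNbrs D x → ¬ w ∈ inNbrs D y
triangle-free-separation D noTriangle y→x w∈N⁺x w∈N⁻y =
  noTriangle _ _ _ y→x (out-nbr⇒arc D w∈N⁺x) (in-nbr⇒arc D w∈N⁻y)

≤+⇒-≤ : ∀ m s k → m ≤ s + k → + m - + k ≤ℤ + s
≤+⇒-≤ m s k m≤s+k = begin
  + m - + k          ≡⟨ ℤ.[+m]-[+n]≡m⊖n m k ⟩
  m ⊖ k              ≤⟨ ℤ.⊖-monoˡ-≤ k m≤s+k ⟩
  (s + k) ⊖ k        ≡⟨ cong (_⊖ k) (+-comm s k) ⟩
  (k + s) ⊖ k        ≡⟨ cong ((k + s) ⊖_) (sym (+-identityʳ k)) ⟩
  (k + s) ⊖ (k + 0)  ≡⟨ ℤ.+-cancelˡ-⊖ k s 0 ⟩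
  s ⊖ 0              ≡⟨ ℤ.⊖-≥ z≤n ⟩
  + s                ∎
  where open ℤ.≤-Reasoning

two-semi-degrees : ∀ {n} (D : Digraph n) {d : ℕ} → MinSemiDegree D d →
  ∀ x y → 2 * d ≤ outDeg D x + inDeg D y
two-semi-degrees D {d} (minDeg , _) x y =
  subst (_≤ outDeg D x + inDeg D y) (cong (λ m → d + m) (sym (+-identityʳ d)))
    (+-mono-≤ (proj₁ (minDeg x)) (proj₂ (minDeg y)))

lemma2p1 : ∀ {n} (D : Digraph n) (d k : ℕ) → 1 ≤ d → Oriented D →
    MinSemiDegree D d → StrongConnectivity D k →
    (K A B : Subset n) → ∣ K ∣ ≡ k → Disconnects D K →
    PartitionOfComplement K A B → (∃[ a ] a ∈ A) → (∃[ b ] b ∈ B) →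
    (∀ b a → b ∈ B → a ∈ A → ¬ Arc D b a) →
    NoDirectedTriangle D →
    ∀ y x → y ∈ A → x ∈ B → Arc D y x →
    (+ (2 * d)) - (+ k) ≤ℤ + (outDegIn D B x + inDegIn D A y)
lemma2p1 D d k _ _ minSemiDeg _ K A B ∣K∣≡k _ part _ _ noBA noTriangle y x y∈A x∈B y→x =
  ≤+⇒-≤ (2 * d) (outDegIn D B x + inDegIn D A y) k (begin
    2 * d                                    ≤⟨ two-semi-degrees D minSemiDeg x y ⟩
    outDeg D x + inDeg D y                   ≤⟨ degree-split ⟩
    outDegIn D B x + inDegIn D A y + ∣ K ∣   ≡⟨ cong (λ m → outDegIn D B x + inDegIn D A y + m) ∣K∣≡k ⟩
    outDegIn D B x + inDegIn D A y + k       ∎)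
  where
  open ≤-Reasoning
  degree-split : outDeg D x + inDeg D y ≤ outDegIn D B x + inDegIn D A y + ∣ K ∣
  degree-split = two-covers-bound (outNbrs D x) (inNbrs D y) B A K
    (outNbrs-of-B D part noBA x∈B) (inNbrs-of-A D part noBA y∈A)
    (λ w∈N⁺x w∈N⁻y _ → triangle-free-separation D noTriangle y→x w∈N⁺x w∈N⁻y)
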